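{- Let $H$ be an instance as described in the context and let $\ell_p$ be the maximum length of a program's preference list. Run the following algorithm: initially $M$ matches every agent $a$ to $p^*_a$. Then consider the programs one by one in an arbitrary order; when program $p$ is considered, go through the agents on $p$'s preference list from least preferred to most preferred by $p$, and for each such agent $a$, if there exists $a'\in M(p)$ with $a>_p a'$ and $p>_a M(a)$, then reassign $a$ from $M(a)$ to $p$. Output $M$. Then the total cost $\sum_{p\in\mathcal{B}}|M(p)|c(p)$ of the output is at most $\ell_p$ times the minimum total cost of an $\mathcal{A}$-perfect stable matching in $H$.
   Context: An instance consists of a bipartite graph $(\mathcal{A}\cup\mathcal{B},E)$, agents $\mathcal{A}$, programs $\mathcal{B}$, $(a,p)\in E$ iff mutually acceptable; every agent has a non-empty preference list. Each agent and each program ranks its neighbours in a strict order ($y>_x z$: $x$ prefers $y$ to $z$). Each program $p$ has a non-negative integer cost $c(p)$; programs have no quotas. A matching $M\subseteq E$ assigns each agent to at most one program (a program may receive any number of agents); $M(a)$, $M(p)$ denote partners. An agent prefers any acceptable program to being unmatched. A pair $(a,p)\in E\setminus M$ blocks $M$ if $p>_a M(a)$ and there is $a'\in M(p)$ with $a>_p a'$; $M$ is stable if no pair blocks it; $M$ is $\mathcal{A}$-perfect if every agent is matched. For an agent $a$, $p^*_a$ is the program of minimum cost on $a$'s preference list, ties broken in favour of the program $a$ prefers most. -}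

module Defs where

open import Data.Nat using (ℕ; _+_; _*_; _⊔_; _≤_; _<_)
open import Data.Fin using (Fin) renaming (_≟_ to _≟F_)
open import Data.Fin.Properties using () 
open import Data.List using (List; []; _∷_; length; filter; map; allFin; reverse; foldr)
open import Data.Nat.ListAction using (sum)
open import Data.List.Membership.Propositional using (_∈_)
open import Data.List.Relation.Unary.Unique.Propositional using (Unique)
open import Data.Maybe using (Maybe; just; nothing)
open import Data.Maybe.Properties using (≡-dec)
open import Data.Product using (Σ; ∃; ∃-syntax; _×_)
open import Data.Unit using (⊤)
open import Data.Empty using (⊥)
open import Data.Bool using (if_then_else_)
open import Relation.Nullary using (¬_; does)
open import Relation.Binary.PropositionalEquality using (_≡_; _≢_)
open import Function.Bundles using (_⇔_)

-- Strict order induced by a preference list (earlier = more preferred):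
-- Before y z xs  means y occurs strictly before z in xs, i.e. y >_x z.
data Before {A : Set} (y z : A) : List A → Set where
  here  : ∀ {xs} → z ∈ xs → Before y z (y ∷ xs)
  there : ∀ {x xs} → Before y z xs → Before y z (x ∷ xs)

record Instance (nA nB : ℕ) : Set where
  field
    prefA   : Fin nA → List (Fin nB)      -- agent preference lists, most preferred first
    prefP   : Fin nB → List (Fin nA)      -- program preference lists, most preferred first
    cost    : Fin nB → ℕ
    uniqA   : ∀ a → Unique (prefA a)
    uniqP   : ∀ p → Unique (prefP p)
    mutualE : ∀ a p → (p ∈ prefA a) ⇔ (a ∈ prefP p)
    nonempA : ∀ a → prefA a ≢ []

module _ {nA nB : ℕ} (I : Instance nA nB) where
  open Instance I

  Edge : Fin nA → Fin nB → Set
  Edge a p = p ∈ prefA a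

  Assignment : Set
  Assignment = Fin nA → Maybe (Fin nB)

  IsMatching : Assignment → Set
  IsMatching M = ∀ a p → M a ≡ just p → Edge a p

  PrefersA : Fin nA → Fin nB → Maybe (Fin nB) → Set
  PrefersA a p nothing  = ⊤
  PrefersA a p (just q) = Before p q (prefA a)

  Blocks : Assignment → Fin nA → Fin nB → Set
  Blocks M a p = Edge a p × M a ≢ just p × PrefersA a p (M a)
               × (∃[ a' ] (M a' ≡ just p × Before a a' (prefP p)))

  Stable : Assignment → Set
  Stable M = ∀ a p → ¬ Blocks M a p

  APerfect : Assignment → Set
  APerfect M = ∀ a → ∃[ p ] M a ≡ just p

  load : Assignment → Fin nB → ℕ
  load M p = length (filter (λ a → ≡-dec _≟F_ (M a) (just p)) (allFin nA))

  totalCost : Assignment → ℕ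
  totalCost M = sum (map (λ p → load M p * cost p) (allFin nB))

  ℓp : ℕ
  ℓp = foldr _⊔_ 0 (map (λ p → length (prefP p)) (allFin nB))

  IsPStar : Fin nA → Fin nB → Set
  IsPStar a p = p ∈ prefA a
              × (∀ q → q ∈ prefA a → cost p ≤ cost q)
              × (∀ q → q ∈ prefA a → cost q ≡ cost p → q ≢ p → Before p q (prefA a))

  update : Assignment → Fin nA → Fin nB → Assignment
  update M a p x = if does (x ≟F a) then just p else M x

  Cond : Assignment → Fin nB → Fin nA → Set
  Cond M p a = (∃[ a' ] (M a' ≡ just p × Before a a' (prefP p))) × PrefersA a p (M a)

  data ProcAgents (p : Fin nB) : List (Fin nA) → Assignment → Assignment → Set where
    done   : ∀ {M} → ProcAgents p [] M M
    move   : ∀ {a as M M'} → Cond M p a → ProcAgents p as (update M a p) M'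
           → ProcAgents p (a ∷ as) M M'
    stay   : ∀ {a as M M'} → ¬ Cond M p a → ProcAgents p as M M'
           → ProcAgents p (a ∷ as) M M'

  data Run : List (Fin nB) → Assignment → Assignment → Set where
    done : ∀ {M} → Run [] M M
    step : ∀ {p ps M M' M''} → ProcAgents p (reverse (prefP p)) M M'
         → Run ps M' M'' → Run (p ∷ ps) M M''

  AlgOutput : List (Fin nB) → Assignment → Set
  AlgOutput order M = ∃[ M₀ ] ((∀ a → ∃[ p ] (M₀ a ≡ just p × IsPStar a p)) × Run order M₀ M)

{-# OPTIONS --safe #-}
-- Each agent's initial program p*_a is the cheapest on its list, so the initial matching M₀
-- costs no more than any A-perfect matching, stable or not. During the run an agent only
-- moves to a program that already holds an agent, so every program used by the output was
-- used by M₀; since it holds only agents acceptable to it, its load grows by a factor of at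
-- most ℓ_p.
module Submission where

open import Defs
open import Data.Nat using (ℕ; zero; suc; _+_; _*_; _⊔_; _≤_; _<_; z≤n; z<s)
open import Data.Nat.Properties
  using (+-*-semiring; +-mono-≤; +-identityʳ; *-identityʳ; *-assoc; *-monoˡ-≤; *-monoʳ-≤;
         ≤-trans; ≤-reflexive; m≤m+n; m≤n+m; m≤m⊔n; m≤n⇒m≤o⊔n; module ≤-Reasoning)
open import Algebra.Properties.Semiring.Sum +-*-semiring
  using (sum-syntax; sum-cong-≗; sum-replicate-zero; ∑-comm; ∑-distrib-+;
         *-distribˡ-sum; *-distribʳ-sum)
  renaming (sum to ∑)
open import Data.Nat.ListAction using (sum)
open import Data.List using (List; []; _∷_; length; filter; foldr; tabulate; allFin)
open import Data.List.Properties using (map-tabulate; filter-some)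
open import Data.List.Membership.Propositional using (_∈_; lose)
open import Data.List.Membership.Propositional.Properties using (∈-allFin; ∈-map⁺; ∈-filter⁻)
open import Data.List.Relation.Unary.Any using (here; there)
open import Data.List.Relation.Binary.Permutation.Propositional using (_↭_)
open import Data.Fin using (Fin; zero; suc; _≟_)
open import Data.Maybe using (Maybe; just; nothing; maybe)
open import Data.Maybe.Properties using (≡-dec; just-injective)
open import Data.Product using (∃-syntax; _×_; _,_; proj₁; proj₂)
open import Data.Bool using (if_then_else_)
open import Function using (id; _∘_)
open import Function.Bundles using (Equivalence)
open import Relation.Nullary using (Dec; yes; no; does)
open import Relation.Binary.PropositionalEquality

∑-mono-≤ : ∀ {n} {f g : Fin n → ℕ} → (∀ i → f i ≤ g i) → ∑ f ≤ ∑ g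
∑-mono-≤ {zero}  f≤g = z≤n
∑-mono-≤ {suc n} f≤g = +-mono-≤ (f≤g zero) (∑-mono-≤ (f≤g ∘ suc))

sum-tabulate : ∀ {n} (f : Fin n → ℕ) → sum (tabulate f) ≡ ∑ f
sum-tabulate {zero}  f = refl
sum-tabulate {suc n} f = cong (f zero +_) (sum-tabulate (f ∘ suc))

length-filter-tabulate : ∀ {a p} {A : Set a} {P : A → Set p} (P? : ∀ x → Dec (P x))
                         {n} (f : Fin n → A) →
                         length (filter P? (tabulate f)) ≡ ∑[ i < n ] (if does (P? (f i)) then 1 else 0)
length-filter-tabulate P? {zero}  f = refl
length-filter-tabulate P? {suc n} f with P? (f zero)
... | yes _ = cong suc (length-filter-tabulate P? (f ∘ suc))
... | no _  = length-filter-tabulate P? (f ∘ suc)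

-- The Kronecker delta [m ≡ just i], decided exactly as in the filter defining `load`.
δ : ∀ {n} → Maybe (Fin n) → Fin n → ℕ
δ m i = if does (≡-dec _≟_ m (just i)) then 1 else 0

δ-refl : ∀ {n} (i : Fin n) → δ (just i) i ≡ 1
δ-refl zero    = refl
δ-refl (suc i) = δ-refl i

∑-δ-sift : ∀ {n} (m : Maybe (Fin n)) (c : Fin n → ℕ) → ∑[ i < n ] (δ m i * c i) ≡ maybe c 0 m
∑-δ-sift {n}     nothing        c = sum-replicate-zero n
∑-δ-sift {suc n} (just zero)    c =
  trans (cong₂ _+_ (+-identityʳ (c zero)) (sum-replicate-zero n)) (+-identityʳ (c zero))
∑-δ-sift {suc n} (just (suc j)) c = ∑-δ-sift (just j) (c ∘ suc)

∑-δ≤length : ∀ {n k} (m : Fin n → Maybe (Fin k)) (q : Fin k) (ys : List (Fin n)) →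
             (∀ i → m i ≡ just q → i ∈ ys) → ∑[ i < n ] δ (m i) q ≤ length ys
∑-δ≤length {n} m q ys covered = begin
  ∑[ i < n ] δ (m i) q          ≤⟨ ∑-mono-≤ δ≤multiplicity ⟩
  ∑[ i < n ] multiplicity ys i  ≡⟨ ∑-multiplicity ys ⟩
  length ys                     ∎
  where
  open ≤-Reasoning

  multiplicity : List (Fin n) → Fin n → ℕ
  multiplicity []       i = 0
  multiplicity (y ∷ ys) i = δ (just y) i + multiplicity ys i

  multiplicity-∈ : ∀ {i} ys → i ∈ ys → 1 ≤ multiplicity ys i
  multiplicity-∈ {i} (y ∷ ys) (here refl) = ≤-trans (≤-reflexive (sym (δ-refl i))) (m≤m+n _ _)
  multiplicity-∈     (y ∷ ys) (there i∈ys) = ≤-trans (multiplicity-∈ ys i∈ys) (m≤n+m _ _)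

  ∑-multiplicity : ∀ ys → ∑[ i < n ] multiplicity ys i ≡ length ys
  ∑-multiplicity []       = sum-replicate-zero n
  ∑-multiplicity (y ∷ ys) = begin-equality
    ∑[ i < n ] (δ (just y) i + multiplicity ys i)           ≡⟨ ∑-distrib-+ (δ (just y)) (multiplicity ys) ⟩
    ∑[ i < n ] δ (just y) i + ∑[ i < n ] multiplicity ys i  ≡⟨ cong₂ _+_ ∑-δ-just (∑-multiplicity ys) ⟩
    1 + length ys                                          ∎
    where
    ∑-δ-just : ∑[ i < n ] δ (just y) i ≡ 1
    ∑-δ-just = trans (sum-cong-≗ (λ i → sym (*-identityʳ (δ (just y) i)))) (∑-δ-sift (just y) (λ _ → 1))

  δ≤multiplicity : ∀ i → δ (m i) q ≤ multiplicity ys i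
  δ≤multiplicity i with ≡-dec _≟_ (m i) (just q)
  ... | yes mi≡q = multiplicity-∈ ys (covered i mi≡q)
  ... | no _     = z≤n

∈⇒≤-foldr-⊔ : ∀ {m ns} → m ∈ ns → m ≤ foldr _⊔_ 0 ns
∈⇒≤-foldr-⊔ {m}          (here refl)  = m≤m⊔n m _
∈⇒≤-foldr-⊔ {ns = n ∷ _} (there m∈ns) = m≤n⇒m≤o⊔n n (∈⇒≤-foldr-⊔ m∈ns)

Before⇒∈ : ∀ {A : Set} {y z : A} {xs} → Before y z xs → y ∈ xs
Before⇒∈ (here _)  = here refl
Before⇒∈ (there b) = there (Before⇒∈ b)

module _ {nA nB : ℕ} (I : Instance nA nB) where
  open Instance I

  agentCost : Assignment I → Fin nA → ℕ
  agentCost M a = maybe cost 0 (M a)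

  occupies? : (M : Assignment I) (p : Fin nB) (a : Fin nA) → Dec (M a ≡ just p)
  occupies? M p a = ≡-dec _≟_ (M a) (just p)

  load≡∑δ : ∀ M p → load I M p ≡ ∑[ a < nA ] δ (M a) p
  load≡∑δ M p = length-filter-tabulate (occupies? M p) id

  totalCost≡∑load : ∀ M → totalCost I M ≡ ∑[ p < nB ] (load I M p * cost p)
  totalCost≡∑load M = trans (cong sum (map-tabulate id loadCost)) (sum-tabulate loadCost)
    where
    loadCost : Fin nB → ℕ
    loadCost p = load I M p * cost p

  totalCost≡∑agentCost : ∀ M → totalCost I M ≡ ∑[ a < nA ] agentCost M a
  totalCost≡∑agentCost M = begin
    totalCost I M                                 ≡⟨ totalCost≡∑load M ⟩
    ∑[ p < nB ] (load I M p * cost p)             ≡⟨ sum-cong-≗ load*cost ⟩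
    ∑[ p < nB ] ∑[ a < nA ] (δ (M a) p * cost p)  ≡⟨ ∑-comm (λ p a → δ (M a) p * cost p) ⟩
    ∑[ a < nA ] ∑[ p < nB ] (δ (M a) p * cost p)  ≡⟨ sum-cong-≗ (λ a → ∑-δ-sift (M a) cost) ⟩
    ∑[ a < nA ] agentCost M a                     ∎
    where
    open ≡-Reasoning
    load*cost : ∀ p → load I M p * cost p ≡ ∑[ a < nA ] (δ (M a) p * cost p)
    load*cost p = trans (cong (_* cost p) (load≡∑δ M p)) (*-distribʳ-sum (cost p) (λ a → δ (M a) p))

  agentCost≤⇒totalCost≤ : ∀ M M′ → (∀ a → agentCost M a ≤ agentCost M′ a) →
                          totalCost I M ≤ totalCost I M′
  agentCost≤⇒totalCost≤ M M′ M≤M′ = begin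
    totalCost I M              ≡⟨ totalCost≡∑agentCost M ⟩
    ∑[ a < nA ] agentCost M a  ≤⟨ ∑-mono-≤ M≤M′ ⟩
    ∑[ a < nA ] agentCost M′ a ≡⟨ totalCost≡∑agentCost M′ ⟨
    totalCost I M′             ∎
    where open ≤-Reasoning

  load≤k*load⇒totalCost≤k*totalCost : ∀ k M M′ → (∀ p → load I M p ≤ k * load I M′ p) →
                                      totalCost I M ≤ k * totalCost I M′
  load≤k*load⇒totalCost≤k*totalCost k M M′ M≤kM′ = begin
    totalCost I M                               ≡⟨ totalCost≡∑load M ⟩
    ∑[ p < nB ] (load I M p * cost p)           ≤⟨ ∑-mono-≤ (λ p → *-monoˡ-≤ (cost p) (M≤kM′ p)) ⟩
    ∑[ p < nB ] (k * load I M′ p * cost p)      ≡⟨ sum-cong-≗ (λ p → *-assoc k (load I M′ p) (cost p)) ⟩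
    ∑[ p < nB ] (k * (load I M′ p * cost p))    ≡⟨ *-distribˡ-sum k (λ p → load I M′ p * cost p) ⟨
    k * ∑[ p < nB ] (load I M′ p * cost p)      ≡⟨ cong (k *_) (totalCost≡∑load M′) ⟨
    k * totalCost I M′                          ∎
    where open ≤-Reasoning

  Used : Assignment I → Fin nB → Set
  Used M p = ∃[ a ] M a ≡ just p

  used⇒load-pos : ∀ {M p} → Used M p → 0 < load I M p
  used⇒load-pos {M} {p} (a , a↦p) = filter-some (occupies? M p) {allFin nA} (lose (∈-allFin a) a↦p)

  load-pos⇒used : ∀ {M p} → 0 < load I M p → Used M p
  load-pos⇒used {M} {p} _ with filter (occupies? M p) (allFin nA) in occupants
  ... | a ∷ _ = a , proj₂ (∈-filter⁻ (occupies? M p) {xs = allFin nA} a∈occupants)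
    where
    a∈occupants : a ∈ filter (occupies? M p) (allFin nA)
    a∈occupants = subst (a ∈_) (sym occupants) (here refl)

  load≤length : ∀ M p → (∀ a → M a ≡ just p → a ∈ prefP p) → load I M p ≤ length (prefP p)
  load≤length M p acceptable =
    subst (_≤ length (prefP p)) (sym (load≡∑δ M p)) (∑-δ≤length M p (prefP p) acceptable)

  length≤ℓp : ∀ p → length (prefP p) ≤ ℓp I
  length≤ℓp p = ∈⇒≤-foldr-⊔ (∈-map⁺ (λ q → length (prefP q)) (∈-allFin p))

  Confined : Assignment I → Assignment I → Set
  Confined M₀ M = ∀ a p → M a ≡ just p → a ∈ prefP p × Used M₀ p

  load≤ℓp*load : ∀ {M₀ M} → Confined M₀ M → ∀ p → load I M p ≤ ℓp I * load I M₀ p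
  load≤ℓp*load {M₀} {M} confined p with load I M p in loadM
  ... | zero  = z≤n
  ... | suc k = begin
    suc k               ≡⟨ loadM ⟨
    load I M p          ≤⟨ load≤length M p (λ a a↦p → proj₁ (confined a p a↦p)) ⟩
    length (prefP p)    ≤⟨ length≤ℓp p ⟩
    ℓp I                ≡⟨ *-identityʳ (ℓp I) ⟨
    ℓp I * 1            ≤⟨ *-monoʳ-≤ (ℓp I) (used⇒load-pos usedByM₀) ⟩
    ℓp I * load I M₀ p  ∎
    where
    open ≤-Reasoning
    usedByM₀ : Used M₀ p
    usedByM₀ = let a , a↦p = load-pos⇒used (subst (0 <_) (sym loadM) z<s)
               in proj₂ (confined a p a↦p)

  update-confined : ∀ {M₀ M p a} → Confined M₀ M → Cond I M p a → Confined M₀ (update I M a p)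
  update-confined {M₀} {M} {p} {a} confined ((a′ , a′↦p , a>a′) , _) b q b↦q with b ≟ a
  ... | yes refl = subst (λ r → a ∈ prefP r × Used M₀ r) (just-injective b↦q)
                         (Before⇒∈ a>a′ , proj₂ (confined a′ p a′↦p))
  ... | no _     = confined b q b↦q

  procAgents-confined : ∀ {M₀ p as M M′} → ProcAgents I p as M M′ → Confined M₀ M → Confined M₀ M′
  procAgents-confined done              confined = confined
  procAgents-confined (move moves rest) confined = procAgents-confined rest (update-confined confined moves)
  procAgents-confined (stay _ rest)     confined = procAgents-confined rest confined

  run-confined : ∀ {M₀ ps M M′} → Run I ps M M′ → Confined M₀ M → Confined M₀ M′
  run-confined done               confined = confined
  run-confined (step agents rest) confined = run-confined rest (procAgents-confined agents confined)

  pStar-confined : ∀ {M₀} → (∀ a → ∃[ p ] (M₀ a ≡ just p × IsPStar I a p)) → Confined M₀ M₀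
  pStar-confined {M₀} pStar a p a↦p with pStar a
  ... | q , a↦q , q∈prefA , _ = subst (λ r → a ∈ prefP r) (just-injective (trans (sym a↦q) a↦p))
                                      (Equivalence.to (mutualE a q) q∈prefA)
                              , (a , a↦p)

  pStar-cost≤agentCost : ∀ {M*} → IsMatching I M* → APerfect I M* →
                         ∀ {a p} → IsPStar I a p → cost p ≤ agentCost M* a
  pStar-cost≤agentCost {M*} matching perfect {a} (_ , cheapest , _) with perfect a
  ... | q , a↦q rewrite a↦q = cheapest q (matching a q a↦q)

lemma5 : ∀ {nA nB} (I : Instance nA nB) (order : List (Fin nB)) → order ↭ allFin nB →
         ∀ M → AlgOutput I order M →
         ∀ M* → IsMatching I M* → APerfect I M* → Stable I M* →
         totalCost I M ≤ ℓp I * totalCost I M*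
lemma5 I _ _ M (M₀ , pStar , run) M* matching perfect _ = begin
  totalCost I M          ≤⟨ load≤k*load⇒totalCost≤k*totalCost I (ℓp I) M M₀ (load≤ℓp*load I confined) ⟩
  ℓp I * totalCost I M₀  ≤⟨ *-monoʳ-≤ (ℓp I) (agentCost≤⇒totalCost≤ I M₀ M* M₀≤M*) ⟩
  ℓp I * totalCost I M*  ∎
  where
  open ≤-Reasoning
  confined : Confined I M₀ M
  confined = run-confined I run (pStar-confined I pStar)
  M₀≤M* : ∀ a → agentCost I M₀ a ≤ agentCost I M* a
  M₀≤M* a with pStar a
  ... | p , a↦p , p* rewrite a↦p = pStar-cost≤agentCost I matching perfect p*
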